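{- Let $n\ge1$, $r\in[n]$, $T\in\mathcal{T}_n$ and $T'=\Phi_r(T)$, with $\sigma$ the associated permutation. For every vertex $v\in[n]$, the local sibship of $v$ in $T$ equals the set of children of $\sigma(v)$ in the rooted tree $T'$ (rooted at $r$). Consequently, the set of nonempty local sibships of $T$ (a set partition of $[n]\setminus\{r\}$) coincides with the set of nonempty child-groups of $T'$.
   Context: $\mathcal{T}_n$ is the set of unrooted labeled trees on $[n]=\{1,\dots,n\}$. Hanging $T$ at $r$: for each edge of $T$, the endpoint closer to $r$ is the parent and the other endpoint is the child, and the edge is labeled by its child endpoint. Edges carry the local orientation $i\to j$ when $i<j$. The local sibship of a vertex $v$ in $T$ (hung at $r$) is the set of labels of edges locally oriented towards $v$, that is, $\{\text{child endpoint of } e : e \text{ an edge } \{u,v\} \text{ of } T \text{ with } u<v\}$. A child-group of a rooted tree is the set of children of a vertex. Construction of $\Phi_r$ and $\sigma$. An edge of $T$ with child $c$ and parent $u$ is good if $c<u$ and bad if $c>u$. Deleting all good edges leaves a forest with components $I_1,\dots,I_d$. Each $I_h$ is rooted at its vertex closest to $r$, and every vertex of $I_h$ is larger than its parent in $I_h$. For each $I_h$, list its vertices in postorder. Recursively, if the root $v$ has children $c_1<\dots<c_s$ in $I_h$, the postorder is the concatenation of the postorders of the subtrees at $c_1,\dots,c_s$, followed by $v$. Call the resulting word $v_1,\dots,v_l$, so $v_l$ is the root of $I_h$. $\sigma$ is the permutation of $[n]$ sending, on each component's word, $v_t\mapsto v_{t+1}$ for $t<l$ and $v_l\mapsto v_1$.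 $\Phi_r(T)$ is the tree on $[n]$, rooted at $r$, whose edges are: - $\{v_t,v_{t+1}\}$ for every component word and every $1\le t<l$; - $\{i,\sigma(j)\}$ for every good edge of $T$ with child $i$ and parent $j$. -}

module Defs where

open import Data.Bool using (Bool; true; false; _∧_; _∨_; not; if_then_else_)
open import Data.Nat using (ℕ; zero; suc; _∸_)
open import Data.Fin using (Fin; _≟_; _<?_)
open import Data.Fin.Base using (_<_)
open import Data.Bool.ListAction using (any)
open import Data.List using (List; []; _∷_; _++_; [_]; length; filterᵇ; concatMap; allFin; upTo; zip; drop; take; map)
open import Data.Product using (_×_; _,_; Σ; ∃)
open import Data.Sum using (_⊎_)
open import Relation.Binary.PropositionalEquality using (_≡_)
open import Relation.Nullary.Decidable using (⌊_⌋)

-- Vertices are Fin n (the labels 0,…,n-1 play the role of 1,…,n,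
-- with the same order).  A graph is a list of (undirected) edges.
Edges : ℕ → Set
Edges n = List (Fin n × Fin n)

_==_ : ∀ {n} → Fin n → Fin n → Bool
a == b = ⌊ a ≟ b ⌋

_<ᵇ_ : ∀ {n} → Fin n → Fin n → Bool
a <ᵇ b = ⌊ a <? b ⌋

adj : ∀ {n} → Edges n → Fin n → Fin n → Bool
adj E a b = any (λ e → ((Data.Product.proj₁ e == a) ∧ (Data.Product.proj₂ e == b))
                      ∨ ((Data.Product.proj₁ e == b) ∧ (Data.Product.proj₂ e == a))) E

data Reach {n} (E : Edges n) : Fin n → Fin n → Set where
  here : ∀ {a} → Reach E a a
  step : ∀ {a b c} → adj E a b ≡ true → Reach E b c → Reach E a c

IsTree : ∀ {n} → Edges n → Set
IsTree {n} E = (length E ≡ n ∸ 1) × (∀ u v → Reach E u v)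

-- within E r k x : the distance from r to x in E is at most k
within : ∀ {n} → Edges n → Fin n → ℕ → Fin n → Bool
within E r zero    x = r == x
within {n} E r (suc k) x =
  within E r k x ∨ any (λ y → within E r k y ∧ adj E y x) (allFin n)

closer : ∀ {n} → Edges n → Fin n → Fin n → Fin n → Bool
closer {n} E r u c = any (λ k → within E r k u ∧ not (within E r k c)) (upTo n)

-- isParent E r c u : in E hung at r, u is the parent of c
-- (c, u are the endpoints of an edge and u is the endpoint closer to r)
isParent : ∀ {n} → Edges n → Fin n → Fin n → Fin n → Bool
isParent E r c u = adj E u c ∧ closer E r u c

ChildOf : ∀ {n} → Edges n → Fin n → Fin n → Fin n → Set
ChildOf E r c u = isParent E r c u ≡ true

LocalSib : ∀ {n} → Edges n → Fin n → Fin n → Fin n → Set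
LocalSib {n} E r v c =
  Σ (Fin n) λ u → (adj E u v ≡ true) × (u < v) ×
    (((isParent E r u v ≡ true) × (c ≡ u)) ⊎ ((isParent E r v u ≡ true) × (c ≡ v)))

-- children of v in its component of the forest obtained by deleting
-- good edges: children c of v with v < c (bad edges), in increasing order
badChildren : ∀ {n} → Edges n → Fin n → Fin n → List (Fin n)
badChildren {n} E r v = filterᵇ (λ c → isParent E r c v ∧ (v <ᵇ c)) (allFin n)

isCompRoot : ∀ {n} → Edges n → Fin n → Fin n → Bool
isCompRoot {n} E r v = not (any (λ u → isParent E r v u ∧ (u <ᵇ v)) (allFin n))

-- postorder of the component subtree at v (fuel f; f = n suffices)
postorder : ∀ {n} → Edges n → Fin n → ℕ → Fin n → List (Fin n)
postorder E r zero    v = [ v ]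
postorder E r (suc f) v = concatMap (postorder E r f) (badChildren E r v) ++ [ v ]

words : ∀ {n} → Edges n → Fin n → List (List (Fin n))
words {n} E r = map (postorder E r n) (filterᵇ (isCompRoot E r) (allFin n))

cycPairs : ∀ {n} → List (Fin n) → List (Fin n × Fin n)
cycPairs w = zip w (drop 1 w ++ take 1 w)

pathPairs : ∀ {n} → List (Fin n) → List (Fin n × Fin n)
pathPairs w = zip w (drop 1 w)

lookupAssoc : ∀ {n} → List (Fin n × Fin n) → Fin n → Fin n
lookupAssoc []            x = x
lookupAssoc ((a , b) ∷ l) x = if a == x then b else lookupAssoc l x

σ : ∀ {n} → Edges n → Fin n → Fin n → Fin n
σ E r = lookupAssoc (concatMap cycPairs (words E r))

goodEdges : ∀ {n} → Edges n → Fin n → List (Fin n × Fin n)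
goodEdges {n} E r =
  concatMap (λ i → map (λ j → (i , j))
              (filterᵇ (λ j → isParent E r i j ∧ (i <ᵇ j)) (allFin n)))
            (allFin n)

Φ : ∀ {n} → Edges n → Fin n → Edges n
Φ E r = concatMap pathPairs (words E r)
        ++ map (λ e → (Data.Product.proj₁ e , σ E r (Data.Product.proj₂ e))) (goodEdges E r)

module Submission where

-- A tree hung at r is determined by its parent map Q (Q r = r, the
-- edges are the pairs {Q b , b}, every orbit of Q reaches r); conversely,
-- for such Q the hanging of Defs has children c ↦ Q c (ParentFunction).
-- We exhibit parent maps for both trees:
--   * T hung at r has the parent map `parent` (TreeParent); that every edge
--     of T is a parent edge is a counting argument on its n - 1 edges;
--   * the component words of the bad-edge forest are duplicate-free,
--     pairwise disjoint and cover [n] (Components), so σ is a permutation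
--     moving each letter to the next one in its word (Permutation);
--   * Φ T r has the parent map c ↦ σ (attach c), where attach c is c for a
--     bad edge and parent c for a good one (PhiParent).
-- The local sibship of v consists of the c ≢ r with attach c ≡ v, so by
-- injectivity of σ it is the child group of σ v in Φ T r; surjectivity of
-- σ gives the converse correspondence (LocalSibships).

open import Defs
open import Data.Bool using (Bool; true; false; _∧_; _∨_; not; T?; if_then_else_) renaming (_≟_ to _≟ᵇ_)
open import Data.Bool.Properties using (T-≡; T-not-≡; if-cong)
open import Data.Bool.ListAction using (any)
open import Data.Empty using (⊥; ⊥-elim)
open import Data.Fin as F using (Fin; _≟_; toℕ; punchIn; punchOut)
import Data.Fin.Properties as FP
open import Data.List using (List; []; _∷_; _++_; [_]; length; lookup; filterᵇ; concatMap; concat; allFin; upTo; zip; drop; take; map)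
import Data.List.Properties as LP
open import Data.List.Membership.Propositional using (_∈_; find; lose)
open import Data.List.Membership.Propositional.Properties using (∈-allFin; ∈-upTo⁺; ∈-lookup; ∈-++⁺ˡ; ∈-++⁺ʳ; ∈-++⁻; ∈-map⁺; ∈-map⁻; ∈-filter⁺; ∈-filter⁻; ∈-concat⁺′; ∈-concatMap⁺; ∈-concatMap⁻; ∈-∃++)
open import Data.List.Relation.Binary.Disjoint.Propositional using (Disjoint)
open import Data.List.Relation.Unary.All as All using (All; []; _∷_)
import Data.List.Relation.Unary.All.Properties as AllP
open import Data.List.Relation.Unary.AllPairs as AllPairs using (AllPairs; []; _∷_)
import Data.List.Relation.Unary.AllPairs.Properties as AllPairsP
open import Data.List.Relation.Unary.Unique.Propositional using (Unique)
import Data.List.Relation.Unary.Unique.Propositional.Properties as UniqueP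
open import Data.List.Relation.Unary.Any using (here; there; index)
open import Data.List.Relation.Unary.Any.Properties using (any⁺; any⁻; lookup-index)
open import Data.Nat as ℕ using (ℕ; zero; suc; _∸_; _+_; z≤n; s≤s)
import Data.Nat.Properties as ℕP
open import Data.Nat.GeneralisedArithmetic using (iterate)
open import Data.Product using (_×_; _,_; Σ; ∃; proj₁; proj₂)
open import Data.Sum using (_⊎_; inj₁; inj₂)
open import Function.Bundles using (_⇔_; mk⇔; Equivalence)
open import Function.Definitions using (Injective)
open import Relation.Binary.Definitions using (tri<; tri≈; tri>)
open import Relation.Binary.PropositionalEquality using (_≡_; _≢_; refl; sym; trans; cong; cong₂; subst; module ≡-Reasoning)
open import Relation.Nullary using (¬_; Dec; yes; no; ¬?; does)
open import Relation.Nullary.Decidable using (toWitness; fromWitness; fromWitnessFalse; dec-true; dec-false; _×-dec_)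

∧-intro : ∀ {a b} → a ≡ true → b ≡ true → a ∧ b ≡ true
∧-intro refl refl = refl

∧-elim : ∀ {a b} → a ∧ b ≡ true → a ≡ true × b ≡ true
∧-elim {true} {true} refl = refl , refl

∨-elim : ∀ {a b} → a ∨ b ≡ true → a ≡ true ⊎ b ≡ true
∨-elim {true} refl = inj₁ refl
∨-elim {false} eq = inj₂ eq

∨-introˡ : ∀ {a} b → a ≡ true → a ∨ b ≡ true
∨-introˡ b refl = refl

∨-introʳ : ∀ a {b} → b ≡ true → a ∨ b ≡ true
∨-introʳ true refl = refl
∨-introʳ false refl = refl

not-true : ∀ {a} → not a ≡ true → a ≢ true
not-true {true} ()

not-intro : ∀ {a} → a ≢ true → not a ≡ true
not-intro {true} a≢true = ⊥-elim (a≢true refl)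
not-intro {false} _ = refl

==⇒≡ : ∀ {n} {a b : Fin n} → (a == b) ≡ true → a ≡ b
==⇒≡ {a = a} {b} t = toWitness {a? = a ≟ b} (Equivalence.from T-≡ t)

≡⇒== : ∀ {n} {a b : Fin n} → a ≡ b → (a == b) ≡ true
≡⇒== {a = a} {b} eq = Equivalence.to T-≡ (fromWitness {a? = a ≟ b} eq)

≢⇒==false : ∀ {n} {a b : Fin n} → a ≢ b → (a == b) ≡ false
≢⇒==false {a = a} {b} ne = Equivalence.to T-not-≡ (fromWitnessFalse {a? = a ≟ b} ne)

<ᵇ⇒< : ∀ {n} {a b : Fin n} → (a <ᵇ b) ≡ true → a F.< b
<ᵇ⇒< {a = a} {b} t = toWitness {a? = a F.<? b} (Equivalence.from T-≡ t)

<⇒<ᵇ : ∀ {n} {a b : Fin n} → a F.< b → (a <ᵇ b) ≡ true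
<⇒<ᵇ {a = a} {b} lt = Equivalence.to T-≡ (fromWitness {a? = a F.<? b} lt)

any-intro : ∀ {A : Set} {p : A → Bool} {xs x} → x ∈ xs → p x ≡ true → any p xs ≡ true
any-intro {p = p} x∈xs px = Equivalence.to T-≡ (any⁺ p (lose x∈xs (Equivalence.from T-≡ px)))

any-elim : ∀ {A : Set} {p : A → Bool} xs → any p xs ≡ true → Σ A λ x → x ∈ xs × p x ≡ true
any-elim {p = p} xs t =
  let x , x∈xs , px = find (any⁻ p xs (Equivalence.from T-≡ t)) in x , x∈xs , Equivalence.to T-≡ px

∈-filterᵇ⁺ : ∀ {A : Set} (p : A → Bool) {xs x} → x ∈ xs → p x ≡ true → x ∈ filterᵇ p xs
∈-filterᵇ⁺ p x∈xs px = ∈-filter⁺ (λ y → T? (p y)) x∈xs (Equivalence.from T-≡ px)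

∈-filterᵇ⁻ : ∀ {A : Set} (p : A → Bool) xs {x} → x ∈ filterᵇ p xs → x ∈ xs × p x ≡ true
∈-filterᵇ⁻ p xs x∈ = let x∈xs , px = ∈-filter⁻ (λ y → T? (p y)) {xs = xs} x∈ in x∈xs , Equivalence.to T-≡ px

Ends : ∀ {n} → Fin n × Fin n → Fin n → Fin n → Set
Ends e a b = (proj₁ e ≡ a × proj₂ e ≡ b) ⊎ (proj₁ e ≡ b × proj₂ e ≡ a)

Ends-sym : ∀ {n} {a b : Fin n} e → Ends e a b → Ends e b a
Ends-sym e (inj₁ (p , q)) = inj₂ (p , q)
Ends-sym e (inj₂ (p , q)) = inj₁ (p , q)

Ends-unique : ∀ {n} {a b c d : Fin n} e → Ends e a b → Ends e c d → (a ≡ c × b ≡ d) ⊎ (a ≡ d × b ≡ c)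
Ends-unique e (inj₁ (refl , refl)) (inj₁ (refl , refl)) = inj₁ (refl , refl)
Ends-unique e (inj₁ (refl , refl)) (inj₂ (refl , refl)) = inj₂ (refl , refl)
Ends-unique e (inj₂ (refl , refl)) (inj₁ (refl , refl)) = inj₂ (refl , refl)
Ends-unique e (inj₂ (refl , refl)) (inj₂ (refl , refl)) = inj₁ (refl , refl)

joins : ∀ {n} → Fin n → Fin n → Fin n × Fin n → Bool
joins a b e = ((proj₁ e == a) ∧ (proj₂ e == b)) ∨ ((proj₁ e == b) ∧ (proj₂ e == a))

joins⇒Ends : ∀ {n} {a b : Fin n} e → joins a b e ≡ true → Ends e a b
joins⇒Ends e t with ∨-elim t
... | inj₁ q = inj₁ (==⇒≡ (proj₁ (∧-elim q)) , ==⇒≡ (proj₂ (∧-elim q)))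
... | inj₂ q = inj₂ (==⇒≡ (proj₁ (∧-elim q)) , ==⇒≡ (proj₂ (∧-elim q)))

Ends⇒joins : ∀ {n} {a b : Fin n} e → Ends e a b → joins a b e ≡ true
Ends⇒joins (x , y) (inj₁ (refl , refl)) =
  ∨-introˡ ((x == y) ∧ (y == x)) (∧-intro (≡⇒== {a = x} refl) (≡⇒== {a = y} refl))
Ends⇒joins (x , y) (inj₂ (refl , refl)) =
  ∨-introʳ ((x == y) ∧ (y == x)) (∧-intro (≡⇒== {a = x} refl) (≡⇒== {a = y} refl))

adj⇒position : ∀ {n} (E : Edges n) {a b} → adj E a b ≡ true →
  Σ (Fin (length E)) λ j → Ends (lookup E j) a b
adj⇒position E {a} {b} t =
  let found = any⁻ (joins a b) E (Equivalence.from T-≡ t)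
  in index found , joins⇒Ends _ (Equivalence.to T-≡ (lookup-index found))

adj⇒edge : ∀ {n} (E : Edges n) {a b} → adj E a b ≡ true → Σ (Fin n × Fin n) λ e → e ∈ E × Ends e a b
adj⇒edge E t = let j , ends = adj⇒position E t in lookup E j , ∈-lookup j , ends

edge⇒adj : ∀ {n} (E : Edges n) {a b e} → e ∈ E → Ends e a b → adj E a b ≡ true
edge⇒adj E e∈E ends = any-intro e∈E (Ends⇒joins _ ends)

adj-sym : ∀ {n} (E : Edges n) {a b} → adj E a b ≡ true → adj E b a ≡ true
adj-sym E t = let e , e∈E , ends = adj⇒edge E t in edge⇒adj E e∈E (Ends-sym e ends)

iterate-suc : ∀ {A : Set} (f : A → A) x k → iterate f x (suc k) ≡ f (iterate f x k)
iterate-suc f x zero = refl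
iterate-suc f x (suc k) = iterate-suc f (f x) k

iterate-+ : ∀ {A : Set} (f : A → A) x a b → iterate f x (a + b) ≡ iterate f (iterate f x a) b
iterate-+ f x zero b = refl
iterate-+ f x (suc a) b = iterate-+ f (f x) a b

iterate-trans : ∀ {A : Set} (f : A → A) {x y z} a b → iterate f x a ≡ y → iterate f y b ≡ z → iterate f x (a + b) ≡ z
iterate-trans f {x} a b refl refl = iterate-+ f x a b

iterate-fix : ∀ {A : Set} (f : A → A) {x} → f x ≡ x → ∀ k → iterate f x k ≡ x
iterate-fix f fx≡x zero = refl
iterate-fix f fx≡x (suc k) = trans (cong (λ y → iterate f y k) fx≡x) (iterate-fix f fx≡x k)

leastWitness : {P : ℕ → Set} → (∀ k → Dec (P k)) → ∀ k → P k →
  Σ ℕ λ m → P m × (∀ j → j ℕ.< m → ¬ P j)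
leastWitness P? zero p = zero , p , λ j ()
leastWitness {P} P? (suc k) p with P? zero
... | yes p0 = zero , p0 , λ j ()
... | no ¬p0 with leastWitness {λ i → P (suc i)} (λ i → P? (suc i)) k p
... | m , pm , below = suc m , pm , λ { zero _ → ¬p0 ; (suc j) (s≤s j<m) → below j j<m }

-- The first time an orbit of f on Fin n hits r is at most n: the points
-- before it are pairwise distinct, as a repetition would give an earlier hit.
firstHit≤n : ∀ {n} (f : Fin n → Fin n) (r x : Fin n) m → iterate f x m ≡ r →
  (∀ j → j ℕ.< m → iterate f x j ≢ r) → m ℕ.≤ n
firstHit≤n {n} f r x m hit before = FP.injective⇒≤ {f = orbit} orbit-injective
  where
  open ≡-Reasoning
  orbit : Fin m → Fin n
  orbit i = iterate f x (toℕ i)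

  noRepeat : ∀ i j → i ℕ.< j → j ℕ.< m → iterate f x i ≢ iterate f x j
  noRepeat i j i<j j<m eq = before (i + (m ∸ j)) earlier (begin
      iterate f x (i + (m ∸ j))               ≡⟨ iterate-+ f x i (m ∸ j) ⟩
      iterate f (iterate f x i) (m ∸ j)       ≡⟨ cong (λ y → iterate f y (m ∸ j)) eq ⟩
      iterate f (iterate f x j) (m ∸ j)       ≡⟨ sym (iterate-+ f x j (m ∸ j)) ⟩
      iterate f x (j + (m ∸ j))               ≡⟨ cong (iterate f x) (ℕP.m+[n∸m]≡n (ℕP.<⇒≤ j<m)) ⟩
      iterate f x m                           ≡⟨ hit ⟩
      r                                       ∎)
    where
    earlier : i + (m ∸ j) ℕ.< m
    earlier = subst (i + (m ∸ j) ℕ.<_) (ℕP.m+[n∸m]≡n (ℕP.<⇒≤ j<m)) (ℕP.+-monoˡ-< (m ∸ j) i<j)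

  orbit-injective : Injective _≡_ _≡_ orbit
  orbit-injective {i} {j} eq with ℕP.<-cmp (toℕ i) (toℕ j)
  ... | tri< i<j _ _ = ⊥-elim (noRepeat (toℕ i) (toℕ j) i<j (FP.toℕ<n j) eq)
  ... | tri≈ _ i≡j _ = FP.toℕ-injective i≡j
  ... | tri> _ _ j<i = ⊥-elim (noRepeat (toℕ j) (toℕ i) j<i (FP.toℕ<n i) (sym eq))

injective⇒onto : ∀ {m L} (h : Fin m → Fin L) → L ≡ m → Injective _≡_ _≡_ h → ∀ j → ∃ λ i → h i ≡ j
injective⇒onto {L = suc L} h refl h-inj j with FP.any? (λ i → h i ≟ j)
... | yes hit = hit
... | no miss = ⊥-elim (ℕP.<-irrefl refl (FP.injective⇒≤ {f = squeeze} squeeze-injective))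
  where
  avoids : ∀ i → j ≢ h i
  avoids i e = miss (i , sym e)

  squeeze : Fin (suc L) → Fin L
  squeeze i = punchOut (avoids i)

  squeeze-injective : Injective _≡_ _≡_ squeeze
  squeeze-injective eq = h-inj (FP.punchOut-injective (avoids _) (avoids _) eq)

nonRoot-injective⇒onto : ∀ {n L} (r : Fin n) (h : ∀ x → x ≢ r → Fin L) → L ≡ n ∸ 1 →
  (∀ {x y} x≢r y≢r → h x x≢r ≡ h y y≢r → x ≡ y) →
  ∀ j → Σ (Fin n) λ x → Σ (x ≢ r) λ x≢r → h x x≢r ≡ j
nonRoot-injective⇒onto {suc m} {L} r h L≡m h-inj j =
  let i , hit = injective⇒onto h′ L≡m h′-injective j in punchIn r i , FP.punchInᵢ≢i r i , hit
  where
  h′ : Fin m → Fin L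
  h′ i = h (punchIn r i) (FP.punchInᵢ≢i r i)

  h′-injective : Injective _≡_ _≡_ h′
  h′-injective {a} {b} eq = FP.punchIn-injective r a b (h-inj _ _ eq)

record IsParentFunction {n} (E : Edges n) (r : Fin n) (Q : Fin n → Fin n) : Set where
  field
    root-fixed  : Q r ≡ r
    edge⇒parent : ∀ a b → adj E a b ≡ true → (b ≢ r × a ≡ Q b) ⊎ (a ≢ r × b ≡ Q a)
    parent⇒edge : ∀ b → b ≢ r → adj E (Q b) b ≡ true
    reachesRoot : ∀ x → Σ ℕ λ k → iterate Q x k ≡ r

module ParentFunction {n} {E : Edges n} {r : Fin n} {Q : Fin n → Fin n}
                      (isPF : IsParentFunction E r Q) where
  open IsParentFunction isPF

  oneMore : ∀ {x} k → iterate Q x k ≡ r → iterate Q x (suc k) ≡ r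
  oneMore {x} k hit = trans (iterate-suc Q x k) (trans (cong Q hit) root-fixed)

  within⇒iterate : ∀ k x → within E r k x ≡ true → iterate Q x k ≡ r
  within⇒iterate zero x t = sym (==⇒≡ t)
  within⇒iterate (suc k) x t with ∨-elim {within E r k x} t
  ... | inj₁ near = oneMore k (within⇒iterate k x near)
  ... | inj₂ viaNeighbour with any-elim (allFin n) viaNeighbour
  ... | y , _ , yt with ∧-elim {within E r k y} yt
  ... | wy , y~x with edge⇒parent y x y~x
  ... | inj₁ (_ , refl) = within⇒iterate k y wy
  ... | inj₂ (_ , refl) = oneMore (suc k) (oneMore k (within⇒iterate k y wy))

  iterate⇒within : ∀ k x → iterate Q x k ≡ r → within E r k x ≡ true
  iterate⇒within zero x hit = ≡⇒== (sym hit)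
  iterate⇒within (suc k) x hit with x ≟ r
  ... | yes refl = ∨-introˡ _ (iterate⇒within k r (iterate-fix Q root-fixed k))
  ... | no x≢r = ∨-introʳ (within E r k x)
        (any-intro (∈-allFin (Q x)) (∧-intro (iterate⇒within k (Q x) hit) (parent⇒edge x x≢r)))

  firstHit : ∀ x → Σ ℕ λ m → iterate Q x m ≡ r × (∀ j → j ℕ.< m → iterate Q x j ≢ r)
  firstHit x = leastWitness (λ k → iterate Q x k ≟ r) (proj₁ (reachesRoot x)) (proj₂ (reachesRoot x))

  -- an edge {u , c} with c = Q u cannot make c a child of u: u is the farther one
  childOf⇒parent : ∀ {c u} → ChildOf E r c u → c ≢ r × u ≡ Q c
  childOf⇒parent {c} {u} t with ∧-elim {adj E u c} t
  ... | u~c , closer-u with edge⇒parent u c u~c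
  ... | inj₁ c-child = c-child
  ... | inj₂ (_ , refl) with any-elim (upTo n) closer-u
  ... | k , _ , kt with ∧-elim {within E r k u} kt
  ... | wu , not-wc = ⊥-elim (not-true not-wc (iterate⇒within k (Q u) (oneMore k (within⇒iterate k u wu))))

  -- if c needs m + 1 steps to reach r, then Q c is within distance m and c is not
  parent⇒childOf : ∀ {c} → c ≢ r → ChildOf E r c (Q c)
  parent⇒childOf {c} c≢r with firstHit c
  ... | zero , hit , _ = ⊥-elim (c≢r hit)
  ... | suc m , hit , before =
    ∧-intro (parent⇒edge c c≢r)
      (any-intro (∈-upTo⁺ (firstHit≤n Q r c (suc m) hit before))
        (∧-intro (iterate⇒within m (Q c) hit)
                 (not-intro (λ wc → before m (ℕP.n<1+n m) (within⇒iterate m c wc)))))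

  childOf⇔parent : ∀ c u → ChildOf E r c u ⇔ (c ≢ r × u ≡ Q c)
  childOf⇔parent c u = mk⇔ childOf⇒parent (λ { (c≢r , refl) → parent⇒childOf c≢r })

firstOr : ∀ {A : Set} → (A → Bool) → A → List A → A
firstOr f d [] = d
firstOr f d (x ∷ xs) = if f x then x else firstOr f d xs

firstOr-passes : ∀ {A : Set} (f : A → Bool) d xs → any f xs ≡ true → f (firstOr f d xs) ≡ true
firstOr-passes f d [] ()
firstOr-passes f d (x ∷ xs) t with f x in fx
... | true = fx
... | false = firstOr-passes f d xs t

-- That every edge of T arises this way
-- is a counting argument: x ↦ (edge to its parent) is injective from the
-- n - 1 non-root vertices into the n - 1 edges, hence onto.
module TreeParent {n} (r : Fin n) (T : Edges n) (tree : IsTree T) where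

  reach⇒within : ∀ {a c} k → within T r k a ≡ true → Reach T a c → Σ ℕ λ k′ → within T r k′ c ≡ true
  reach⇒within k wa here = k , wa
  reach⇒within {a} k wa (step {b = b} a~b rest) =
    reach⇒within (suc k) (∨-introʳ (within T r k b) (any-intro (∈-allFin a) (∧-intro wa a~b))) rest

  distance : ∀ x → Σ ℕ λ m → within T r m x ≡ true × (∀ j → j ℕ.< m → within T r j x ≢ true)
  distance x =
    let k , wx = reach⇒within 0 (≡⇒== {a = r} refl) (proj₂ tree r x)
    in leastWitness (λ j → within T r j x ≟ᵇ true) k wx

  dist : Fin n → ℕ
  dist x = proj₁ (distance x)

  dist-min : ∀ {k y} → within T r k y ≡ true → dist y ℕ.≤ k
  dist-min {k} {y} wy with ℕP.≤-<-connex (dist y) k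
  ... | inj₁ le = le
  ... | inj₂ lt = ⊥-elim (proj₂ (proj₂ (distance y)) k lt wy)

  isUp : Fin n → Fin n → Bool
  isUp x y = within T r (dist x ∸ 1) y ∧ adj T y x

  parent : Fin n → Fin n
  parent x = if x == r then r else firstOr (isUp x) r (allFin n)

  parent-root : parent r ≡ r
  parent-root = if-cong (≡⇒== {a = r} refl)

  parent-isUp : ∀ x → x ≢ r → isUp x (parent x) ≡ true
  parent-isUp x x≢r = subst (λ y → isUp x y ≡ true) (sym (if-cong (≢⇒==false x≢r))) firstUp
    where
    firstUp : isUp x (firstOr (isUp x) r (allFin n)) ≡ true
    firstUp with distance x
    ... | zero , wx , _ = ⊥-elim (x≢r (sym (==⇒≡ wx)))
    ... | suc m , wx , below with ∨-elim {within T r m x} wx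
    ... | inj₁ wx′ = ⊥-elim (below m (ℕP.n<1+n m) wx′)
    ... | inj₂ up = firstOr-passes _ r (allFin n) up

  parent-adjacent : ∀ x → x ≢ r → adj T (parent x) x ≡ true
  parent-adjacent x x≢r = proj₂ (∧-elim {within T r (dist x ∸ 1) (parent x)} (parent-isUp x x≢r))

  parent-closer : ∀ x → x ≢ r → dist (parent x) ℕ.< dist x
  parent-closer x x≢r =
    ℕP.≤-<-trans (dist-min (proj₁ (∧-elim (parent-isUp x x≢r)))) (ℕP.∸-monoʳ-< {o = 0} (s≤s z≤n) dist-pos)
    where
    dist-pos : 0 ℕ.< dist x
    dist-pos with distance x
    ... | zero , wx , _ = ⊥-elim (x≢r (sym (==⇒≡ wx)))
    ... | suc m , _ , _ = s≤s z≤n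

  parent-dist-≤ : ∀ x → dist (parent x) ℕ.≤ dist x
  parent-dist-≤ x = byCases (x ≟ r)
    where
    byCases : Dec (x ≡ r) → dist (parent x) ℕ.≤ dist x
    byCases (yes x≡r) = ℕP.≤-reflexive (cong dist (trans (cong parent x≡r) (trans parent-root (sym x≡r))))
    byCases (no x≢r) = ℕP.<⇒≤ (parent-closer x x≢r)

  parent-reachesRoot : ∀ x → Σ ℕ λ k → iterate parent x k ≡ r
  parent-reachesRoot x = go (suc (dist x)) x (ℕP.n<1+n (dist x))
    where
    go : ∀ bound x → dist x ℕ.< bound → Σ ℕ λ k → iterate parent x k ≡ r
    go (suc bound) x lt with x ≟ r
    ... | yes x≡r = 0 , x≡r
    ... | no x≢r =
      let k , hit = go bound (parent x) (ℕP.<-≤-trans (parent-closer x x≢r) (ℕP.≤-pred lt))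
      in suc k , hit

  parentEdge : ∀ x → x ≢ r → Fin (length T)
  parentEdge x x≢r = proj₁ (adj⇒position T (parent-adjacent x x≢r))

  parentEdge-ends : ∀ x x≢r → Ends (lookup T (parentEdge x x≢r)) (parent x) x
  parentEdge-ends x x≢r = proj₂ (adj⇒position T (parent-adjacent x x≢r))

  -- two vertices cannot be each other's parent, as the distance decreases
  parentEdge-injective : ∀ {x y} x≢r y≢r → parentEdge x x≢r ≡ parentEdge y y≢r → x ≡ y
  parentEdge-injective {x} {y} x≢r y≢r same
    with Ends-unique _ (parentEdge-ends x x≢r)
           (subst (λ j → Ends (lookup T j) (parent y) y) (sym same) (parentEdge-ends y y≢r))
  ... | inj₁ (_ , x≡y) = x≡y
  ... | inj₂ (px≡y , x≡py) = ⊥-elim (ℕP.<-asym (subst (λ z → dist z ℕ.< dist x) px≡y (parent-closer x x≢r))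
                                        (subst (λ z → dist z ℕ.< dist y) (sym x≡py) (parent-closer y y≢r)))

  edge⇒parent : ∀ a b → adj T a b ≡ true → (b ≢ r × a ≡ parent b) ⊎ (a ≢ r × b ≡ parent a)
  edge⇒parent a b a~b with adj⇒position T a~b
  ... | j , ab-ends with nonRoot-injective⇒onto r parentEdge (proj₁ tree) parentEdge-injective j
  ... | x , x≢r , refl with Ends-unique _ (parentEdge-ends x x≢r) ab-ends
  ... | inj₁ (px≡a , refl) = inj₁ (x≢r , sym px≡a)
  ... | inj₂ (px≡b , refl) = inj₂ (x≢r , sym px≡b)

  isParentFunction : IsParentFunction T r parent
  isParentFunction = record
    { root-fixed  = parent-root
    ; edge⇒parent = edge⇒parent
    ; parent⇒edge = parent-adjacent
    ; reachesRoot = parent-reachesRoot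
    }

zip-keys : ∀ {A B : Set} (xs : List A) (ys : List B) → length xs ℕ.≤ length ys → map proj₁ (zip xs ys) ≡ xs
zip-keys [] ys _ = refl
zip-keys (x ∷ xs) (y ∷ ys) (s≤s le) = cong (x ∷_) (zip-keys xs ys le)

zip-values : ∀ {A B : Set} (xs : List A) (ys : List B) → length ys ℕ.≤ length xs → map proj₂ (zip xs ys) ≡ ys
zip-values [] [] _ = refl
zip-values (x ∷ xs) [] _ = refl
zip-values (x ∷ xs) (y ∷ ys) (s≤s le) = cong (y ∷_) (zip-values xs ys le)

rotate : ∀ {A : Set} → List A → List A
rotate [] = []
rotate (a ∷ t) = t ++ [ a ]

length-rotate : ∀ {A : Set} (a : A) t → length (t ++ [ a ]) ≡ length (a ∷ t)
length-rotate a t = trans (LP.length-++ t) (ℕP.+-comm (length t) 1)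

cycPairs-keys : ∀ {n} (w : List (Fin n)) → map proj₁ (cycPairs w) ≡ w
cycPairs-keys [] = refl
cycPairs-keys (a ∷ t) = zip-keys (a ∷ t) (t ++ [ a ]) (ℕP.≤-reflexive (sym (length-rotate a t)))

cycPairs-values : ∀ {n} (w : List (Fin n)) → map proj₂ (cycPairs w) ≡ rotate w
cycPairs-values [] = refl
cycPairs-values (a ∷ t) = zip-values (a ∷ t) (t ++ [ a ]) (ℕP.≤-reflexive (length-rotate a t))

∈-rotate⁻ : ∀ {A : Set} {x : A} w → x ∈ rotate w → x ∈ w
∈-rotate⁻ (a ∷ t) x∈ with ∈-++⁻ t x∈
... | inj₁ x∈t = there x∈t
... | inj₂ (here refl) = here refl

rotate-unique : ∀ {A : Set} (w : List A) → Unique w → Unique (rotate w)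
rotate-unique [] u = u
rotate-unique (a ∷ t) (a∉t ∷ u) = UniqueP.++⁺ u ([] ∷ []) λ { (a∈t , here refl) → All.lookup a∉t a∈t refl }

rotate-disjoint : ∀ {A : Set} {v w : List A} → Disjoint v w → Disjoint (rotate v) (rotate w)
rotate-disjoint {v = v} {w} disjoint (x∈v , x∈w) = disjoint (∈-rotate⁻ v x∈v , ∈-rotate⁻ w x∈w)

rotate-concat-unique : ∀ {A : Set} {ws : List (List A)} → All Unique ws → AllPairs Disjoint ws →
  Unique (concat (map rotate ws))
rotate-concat-unique u disjoint = UniqueP.concat⁺ (AllP.map⁺ (All.map (λ {w} → rotate-unique w) u))
  (AllPairsP.map⁺ (AllPairs.map rotate-disjoint disjoint))

consecutive∈pathPairs : ∀ {n} (pre : List (Fin n)) x y s → (x , y) ∈ pathPairs (pre ++ x ∷ y ∷ s)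
consecutive∈pathPairs [] x y s = here refl
consecutive∈pathPairs (a ∷ []) x y s = there (consecutive∈pathPairs [] x y s)
consecutive∈pathPairs (a ∷ b ∷ pre) x y s = there (consecutive∈pathPairs (b ∷ pre) x y s)

pathPairs⇒consecutive : ∀ {n} (w : List (Fin n)) {x y} → (x , y) ∈ pathPairs w →
  Σ (List (Fin n)) λ pre → Σ (List (Fin n)) λ s → w ≡ pre ++ x ∷ y ∷ s
pathPairs⇒consecutive (a ∷ b ∷ t) (here refl) = [] , t , refl
pathPairs⇒consecutive (a ∷ b ∷ t) (there p) =
  let pre , s , eq = pathPairs⇒consecutive (b ∷ t) p in a ∷ pre , s , cong (a ∷_) eq

zip-prefix : ∀ {A B : Set} {x : A} {y : B} xs ys zs → (x , y) ∈ zip xs ys → (x , y) ∈ zip xs (ys ++ zs)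
zip-prefix (a ∷ xs) (b ∷ ys) zs (here eq) = here eq
zip-prefix (a ∷ xs) (b ∷ ys) zs (there p) = there (zip-prefix xs ys zs p)

pathPairs⊆cycPairs : ∀ {n} (w : List (Fin n)) {x y} → (x , y) ∈ pathPairs w → (x , y) ∈ cycPairs w
pathPairs⊆cycPairs w = zip-prefix w (drop 1 w) (take 1 w)

init-last : ∀ {A : Set} (a : A) t → Σ (List A) λ init → Σ A λ z → a ∷ t ≡ init ++ [ z ]
init-last a [] = [] , a , refl
init-last a (b ∷ t) = let init , z , eq = init-last b t in a ∷ init , z , cong (a ∷_) eq

last-not-followed : ∀ {A : Set} (init pre s : List A) {z y : A} →
  Unique (init ++ [ z ]) → init ++ [ z ] ≡ pre ++ z ∷ y ∷ s → ⊥
last-not-followed init pre s {z} {y} u eq with init-last y s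
... | ys , z′ , ys≡ with LP.∷ʳ-injective init (pre ++ z ∷ ys)
                          (trans eq (trans (cong (λ t → pre ++ z ∷ t) ys≡) (sym (LP.++-assoc pre (z ∷ ys) [ z′ ]))))
... | refl , refl = noEarlier (pre ++ z ∷ ys) u (∈-++⁺ʳ pre (here refl))
  where
  noEarlier : ∀ xs → Unique (xs ++ [ z ]) → z ∈ xs → ⊥
  noEarlier (a ∷ xs) (a∉ ∷ u) (here refl) = All.lookup a∉ (∈-++⁺ʳ xs (here refl)) refl
  noEarlier (a ∷ xs) (_ ∷ u) (there z∈xs) = noEarlier xs u z∈xs

lookupAssoc-∈ : ∀ {n} (L : List (Fin n × Fin n)) x → x ∈ map proj₁ L → (x , lookupAssoc L x) ∈ L
lookupAssoc-∈ ((a , b) ∷ L) x x∈keys with a ≟ x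
... | yes refl = here refl
lookupAssoc-∈ ((a , b) ∷ L) x (here x≡a) | no a≢x = ⊥-elim (a≢x (sym x≡a))
lookupAssoc-∈ ((a , b) ∷ L) x (there x∈keys) | no _ = there (lookupAssoc-∈ L x x∈keys)

lookupAssoc-spec : ∀ {n} (L : List (Fin n × Fin n)) {x y} → Unique (map proj₁ L) → (x , y) ∈ L → lookupAssoc L x ≡ y
lookupAssoc-spec ((a , b) ∷ L) u (here refl) with a ≟ a
... | yes _ = refl
... | no a≢a = ⊥-elim (a≢a refl)
lookupAssoc-spec ((a , b) ∷ L) {x} (a∉ ∷ u) (there xy∈L) with a ≟ x
... | yes refl = ⊥-elim (All.lookup a∉ (∈-map⁺ proj₁ xy∈L) refl)
... | no _ = lookupAssoc-spec L u xy∈L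

values-injective : ∀ {n} (L : List (Fin n × Fin n)) {a b z} → Unique (map proj₂ L) →
  (a , z) ∈ L → (b , z) ∈ L → a ≡ b
values-injective (e ∷ L) u (here refl) (here refl) = refl
values-injective (e ∷ L) (z∉ ∷ u) (here refl) (there bz) = ⊥-elim (All.lookup z∉ (∈-map⁺ proj₂ bz) refl)
values-injective (e ∷ L) (z∉ ∷ u) (there az) (here refl) = ⊥-elim (All.lookup z∉ (∈-map⁺ proj₂ az) refl)
values-injective (e ∷ L) (_ ∷ u) (there az) (there bz) = values-injective L u az bz

AllPairs-mapWith : ∀ {A : Set} {R S : A → A → Set} {Q : A → Set} →
  (∀ {a b} → Q a → Q b → R a b → S a b) → ∀ {xs} → All Q xs → AllPairs R xs → AllPairs S xs
AllPairs-mapWith {R = R} {S} {Q} f [] [] = []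
AllPairs-mapWith {R = R} {S} {Q} f (qa ∷ qs) (ra ∷ rs) = withHead qa qs ra ∷ AllPairs-mapWith f qs rs
  where
  withHead : ∀ {a ys} → Q a → All Q ys → All (R a) ys → All (S a) ys
  withHead qa [] [] = []
  withHead qa (qb ∷ qs) (r ∷ rs) = f qa qb r ∷ withHead qa qs rs

-- Deleting the good edges leaves
-- components; the root of a component is its unique vertex that is not
-- the child of a bad edge, and the component of ρ consists of the vertices
-- climbing to ρ along bad edges.
module Components {n} (r : Fin n) (T : Edges n) (tree : IsTree T) where
  open TreeParent r T tree public
  module HungT = ParentFunction isParentFunction

  Bad : Fin n → Set
  Bad x = x ≢ r × parent x F.< x

  bad? : ∀ x → Dec (Bad x)
  bad? x = ¬? (x ≟ r) ×-dec (parent x F.<? x)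

  good⇒below-parent : ∀ {x} → x ≢ r → ¬ Bad x → x F.< parent x
  good⇒below-parent {x} x≢r good with FP.<-cmp x (parent x)
  ... | tri< x<px _ _ = x<px
  ... | tri≈ _ x≡px _ = ⊥-elim (ℕP.<-irrefl (cong dist (sym x≡px)) (parent-closer x x≢r))
  ... | tri> _ _ px<x = ⊥-elim (good (x≢r , px<x))

  badChild⇒bad : ∀ {v c} → c ∈ badChildren T r v → Bad c × v ≡ parent c
  badChild⇒bad {v} {c} c∈ with ∧-elim {isParent T r c v} (proj₂ (∈-filterᵇ⁻ _ (allFin n) c∈))
  ... | c-child , v<c with HungT.childOf⇒parent c-child
  ... | c≢r , refl = (c≢r , <ᵇ⇒< v<c) , refl

  bad⇒badChild : ∀ {c} → Bad c → c ∈ badChildren T r (parent c)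
  bad⇒badChild {c} (c≢r , pc<c) =
    ∈-filterᵇ⁺ _ (∈-allFin c) (∧-intro (HungT.parent⇒childOf c≢r) (<⇒<ᵇ pc<c))

  compRoot⇒good : ∀ {v} → isCompRoot T r v ≡ true → ¬ Bad v
  compRoot⇒good {v} t (v≢r , pv<v) =
    not-true t (any-intro (∈-allFin (parent v)) (∧-intro (HungT.parent⇒childOf v≢r) (<⇒<ᵇ pv<v)))

  good⇒compRoot : ∀ {v} → ¬ Bad v → isCompRoot T r v ≡ true
  good⇒compRoot {v} good = not-intro λ t →
    let u , _ , ut = any-elim (allFin n) t
        v-child , u<v = ∧-elim {isParent T r v u} ut
        v≢r , u≡pv = HungT.childOf⇒parent v-child
    in good (v≢r , subst (F._< v) u≡pv (<ᵇ⇒< u<v))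

  data BadPath (ρ : Fin n) : ℕ → Fin n → Set where
    arrived : BadPath ρ 0 ρ
    climb   : ∀ {k x} → Bad x → BadPath ρ k (parent x) → BadPath ρ (suc k) x

  badPath-iterate : ∀ {ρ k x} → BadPath ρ k x → iterate parent x k ≡ ρ
  badPath-iterate arrived = refl
  badPath-iterate (climb _ path) = badPath-iterate path

  badPath-extend : ∀ {c k x} → BadPath c k x → Bad c → BadPath (parent c) (suc k) x
  badPath-extend arrived bad = climb bad arrived
  badPath-extend (climb bad′ path) bad = climb bad′ (badPath-extend path bad)

  badPath-last : ∀ {ρ k x} → BadPath ρ (suc k) x → Σ (Fin n) λ c → c ∈ badChildren T r ρ × BadPath c k x
  badPath-last {k = zero} (climb bad arrived) = _ , bad⇒badChild bad , arrived
  badPath-last {k = suc k} (climb bad path) =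
    let c , c∈ , path′ = badPath-last path in c , c∈ , climb bad path′

  badPath-root-unique : ∀ {ρ₁ ρ₂ k₁ k₂ x} → BadPath ρ₁ k₁ x → BadPath ρ₂ k₂ x → ¬ Bad ρ₁ → ¬ Bad ρ₂ → ρ₁ ≡ ρ₂
  badPath-root-unique arrived arrived _ _ = refl
  badPath-root-unique arrived (climb bad _) good₁ _ = ⊥-elim (good₁ bad)
  badPath-root-unique (climb bad _) arrived _ good₂ = ⊥-elim (good₂ bad)
  badPath-root-unique (climb _ path₁) (climb _ path₂) good₁ good₂ = badPath-root-unique path₁ path₂ good₁ good₂

  climbToRoot : ∀ x → Σ (Fin n) λ ρ → Σ ℕ λ k → ¬ Bad ρ × BadPath ρ k x
  climbToRoot x = go (suc (dist x)) x (ℕP.n<1+n (dist x))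
    where
    go : ∀ bound x → dist x ℕ.< bound → Σ (Fin n) λ ρ → Σ ℕ λ k → ¬ Bad ρ × BadPath ρ k x
    go (suc bound) x lt with bad? x
    ... | no good = x , 0 , good , arrived
    ... | yes bad = let ρ , k , good , path = go bound (parent x) (ℕP.<-≤-trans (parent-closer x (proj₁ bad)) (ℕP.≤-pred lt))
                    in ρ , suc k , good , climb bad path

  -- a path of bad edges avoids r before its end, so it has length at most n
  badPath-length≤n : ∀ {ρ k x} → BadPath ρ k x → k ℕ.≤ n
  badPath-length≤n {k = k} {x} path with HungT.firstHit x
  ... | m , hit , before with ℕP.≤-<-connex k m
  ... | inj₁ k≤m = ℕP.≤-trans k≤m (firstHit≤n parent r x m hit before)
  ... | inj₂ m<k = ⊥-elim (avoidsRoot path m m<k hit)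
    where
    avoidsRoot : ∀ {ρ k x} → BadPath ρ k x → ∀ i → i ℕ.< k → iterate parent x i ≢ r
    avoidsRoot (climb (x≢r , _) _) zero _ = x≢r
    avoidsRoot (climb _ path) (suc i) (s≤s i<k) = avoidsRoot path i i<k

  dist-iterate : ∀ t x → dist (iterate parent x t) ℕ.≤ dist x
  dist-iterate zero x = ℕP.≤-refl
  dist-iterate (suc t) x = ℕP.≤-trans (dist-iterate t (parent x)) (parent-dist-≤ x)

  badPath-dist : ∀ {ρ k x} → BadPath ρ k x → dist ρ ℕ.≤ dist x
  badPath-dist {k = k} {x} path = subst (λ z → dist z ℕ.≤ dist x) (badPath-iterate path) (dist-iterate k x)

  noCycle : ∀ t c → c ≢ r → iterate parent (parent c) t ≢ c
  noCycle t c c≢r back = ℕP.<-irrefl refl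
    (ℕP.≤-<-trans (subst (λ z → dist z ℕ.≤ dist (parent c)) back (dist-iterate t (parent c))) (parent-closer c c≢r))

  postorder-last : ∀ f v → Σ (List (Fin n)) λ pre → postorder T r f v ≡ pre ++ [ v ]
  postorder-last zero v = [] , refl
  postorder-last (suc f) v = _ , refl

  postorder-self : ∀ f v → v ∈ postorder T r f v
  postorder-self f v = let pre , eq = postorder-last f v in subst (v ∈_) (sym eq) (∈-++⁺ʳ pre (here refl))

  postorder⇒badPath : ∀ f v {x} → x ∈ postorder T r f v → Σ ℕ λ k → BadPath v k x
  postorder⇒badPath zero v (here refl) = 0 , arrived
  postorder⇒badPath (suc f) v x∈ with ∈-++⁻ (concatMap (postorder T r f) (badChildren T r v)) x∈
  ... | inj₂ (here refl) = 0 , arrived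
  ... | inj₁ x∈below with find (∈-concatMap⁻ (postorder T r f) {xs = badChildren T r v} x∈below)
  ... | c , c∈ , x∈c with badChild⇒bad c∈
  ... | bad , refl = let k , path = postorder⇒badPath f c x∈c in suc k , badPath-extend path bad

  badPath⇒postorder : ∀ f v {k x} → BadPath v k x → k ℕ.≤ f → x ∈ postorder T r f v
  badPath⇒postorder f v arrived _ = postorder-self f v
  badPath⇒postorder (suc f) v {suc k} path (s≤s k≤f) =
    let c , c∈ , path′ = badPath-last path
    in ∈-++⁺ˡ (∈-concatMap⁺ (postorder T r f) {xs = badChildren T r v} (lose c∈ (badPath⇒postorder f c path′ k≤f)))

  siblings-disjoint : ∀ f {v a b} → Bad a × v ≡ parent a → Bad b × v ≡ parent b → a ≢ b →
    Disjoint (postorder T r f a) (postorder T r f b)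
  siblings-disjoint f {a = a} {b} ((a≢r , _) , va) ((b≢r , _) , vb) a≢b (x∈a , x∈b) =
    meet (proj₁ (postorder⇒badPath f a x∈a)) (proj₁ (postorder⇒badPath f b x∈b))
         (badPath-iterate (proj₂ (postorder⇒badPath f a x∈a))) (badPath-iterate (proj₂ (postorder⇒badPath f b x∈b)))
    where
    meet : ∀ {y} k₁ k₂ → iterate parent y k₁ ≡ a → iterate parent y k₂ ≡ b → ⊥
    meet zero zero refl refl = a≢b refl
    meet zero (suc k₂) refl hit = noCycle k₂ b b≢r (trans (cong (λ z → iterate parent z k₂) (trans (sym vb) va)) hit)
    meet (suc k₁) zero hit refl = noCycle k₁ a a≢r (trans (cong (λ z → iterate parent z k₁) (trans (sym va) vb)) hit)
    meet (suc k₁) (suc k₂) hit₁ hit₂ = meet k₁ k₂ hit₁ hit₂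

  postorder-unique : ∀ f v → Unique (postorder T r f v)
  postorder-unique zero v = [] ∷ []
  postorder-unique (suc f) v =
    UniqueP.++⁺ (UniqueP.concat⁺ (AllP.map⁺ (All.tabulate (λ {c} _ → postorder-unique f c)))
                   (AllPairsP.map⁺ (AllPairs-mapWith (siblings-disjoint f)
                     (All.tabulate badChild⇒bad) (UniqueP.filter⁺ _ (UniqueP.allFin⁺ n)))))
                ([] ∷ [])
                λ { (v∈below , here refl) → notBelow v∈below }
    where
    notBelow : v ∈ concatMap (postorder T r f) (badChildren T r v) → ⊥
    notBelow v∈ with find (∈-concatMap⁻ (postorder T r f) {xs = badChildren T r v} v∈)
    ... | c , c∈ , v∈c with badChild⇒bad c∈ | postorder⇒badPath f c v∈c
    ... | (c≢r , _) , v≡pc | k , path = noCycle k c c≢r (trans (cong (λ z → iterate parent z k) (sym v≡pc)) (badPath-iterate path))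

  -- The component words use fuel n, which bounds every bad path.

  word : Fin n → List (Fin n)
  word = postorder T r n

  word-last : ∀ ρ → Σ (List (Fin n)) λ pre → word ρ ≡ pre ++ [ ρ ]
  word-last = postorder-last n

  word-unique : ∀ ρ → Unique (word ρ)
  word-unique = postorder-unique n

  words⇒root : ∀ {w} → w ∈ words T r → Σ (Fin n) λ ρ → ¬ Bad ρ × w ≡ word ρ
  words⇒root w∈ = let ρ , ρ∈ , eq = ∈-map⁻ word w∈ in ρ , compRoot⇒good (proj₂ (∈-filterᵇ⁻ _ (allFin n) ρ∈)) , eq

  root⇒words : ∀ {ρ} → ¬ Bad ρ → word ρ ∈ words T r
  root⇒words {ρ} good = ∈-map⁺ word (∈-filterᵇ⁺ _ (∈-allFin ρ) (good⇒compRoot good))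

  inRootWord : ∀ x → Σ (Fin n) λ ρ → ¬ Bad ρ × x ∈ word ρ
  inRootWord x = let ρ , k , good , path = climbToRoot x in ρ , good , badPath⇒postorder n ρ path (badPath-length≤n path)

  good-in-word : ∀ {x ρ} → ¬ Bad x → x ∈ word ρ → x ≡ ρ
  good-in-word good x∈ with postorder⇒badPath n _ x∈
  ... | _ , arrived = refl
  ... | _ , climb bad _ = ⊥-elim (good bad)

  words-cover : ∀ x → x ∈ concat (words T r)
  words-cover x = let ρ , good , x∈ = inRootWord x in ∈-concat⁺′ x∈ (root⇒words good)

  words-unique : All Unique (words T r)
  words-unique = AllP.map⁺ (All.tabulate (λ {ρ} _ → word-unique ρ))

  -- words of distinct roots are disjoint, as climbing ends at a unique root
  words-disjoint : AllPairs Disjoint (words T r)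
  words-disjoint = AllPairsP.map⁺ (AllPairs-mapWith distinctRoots
    (All.tabulate (λ ρ∈ → compRoot⇒good (proj₂ (∈-filterᵇ⁻ _ (allFin n) ρ∈)))) (UniqueP.filter⁺ _ (UniqueP.allFin⁺ n)))
    where
    distinctRoots : ∀ {a b} → ¬ Bad a → ¬ Bad b → a ≢ b → Disjoint (word a) (word b)
    distinctRoots good₁ good₂ a≢b (x∈a , x∈b) =
      a≢b (badPath-root-unique (proj₂ (postorder⇒badPath n _ x∈a)) (proj₂ (postorder⇒badPath n _ x∈b)) good₁ good₂)

-- σ is a permutation: it looks x up among the cyclic successor pairs of
-- the words, whose keys (the letters of the words) and values (the letters
-- of the rotated words) are both duplicate-free.  Inside a word σ moves
-- each letter to the next one; the letters followed by another one are
-- exactly the children of bad edges.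
module Permutation {n} (r : Fin n) (T : Edges n) (tree : IsTree T) where
  open Components r T tree public

  successors : List (Fin n × Fin n)
  successors = concatMap cycPairs (words T r)

  successors-keys : ∀ (ws : List (List (Fin n))) → map proj₁ (concatMap cycPairs ws) ≡ concat ws
  successors-keys [] = refl
  successors-keys (w ∷ ws) = trans (LP.map-++ proj₁ (cycPairs w) (concatMap cycPairs ws))
                                   (cong₂ _++_ (cycPairs-keys w) (successors-keys ws))

  successors-values : ∀ (ws : List (List (Fin n))) → map proj₂ (concatMap cycPairs ws) ≡ concat (map rotate ws)
  successors-values [] = refl
  successors-values (w ∷ ws) = trans (LP.map-++ proj₂ (cycPairs w) (concatMap cycPairs ws))
                                     (cong₂ _++_ (cycPairs-values w) (successors-values ws))

  σ-pair : ∀ x → (x , σ T r x) ∈ successors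
  σ-pair x = lookupAssoc-∈ successors x (subst (x ∈_) (sym (successors-keys (words T r))) (words-cover x))

  σ-spec : ∀ {x y} → (x , y) ∈ successors → σ T r x ≡ y
  σ-spec = lookupAssoc-spec successors
             (subst Unique (sym (successors-keys (words T r))) (UniqueP.concat⁺ words-unique words-disjoint))

  σ-injective : Injective _≡_ _≡_ (σ T r)
  σ-injective {a} {b} eq = values-injective successors
    (subst Unique (sym (successors-values (words T r))) (rotate-concat-unique words-unique words-disjoint))
    (σ-pair a) (subst (λ z → (b , z) ∈ successors) (sym eq) (σ-pair b))

  σ-surjective : ∀ z → ∃ λ a → σ T r a ≡ z
  σ-surjective = injective⇒onto (σ T r) refl σ-injective

  σ-sameWord : ∀ x → Σ (Fin n) λ ρ → ¬ Bad ρ × x ∈ word ρ × σ T r x ∈ word ρ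
  σ-sameWord x =
    let w , w∈ , pair∈ = find (∈-concatMap⁻ cycPairs {xs = words T r} (σ-pair x))
        ρ , good , w≡ = words⇒root w∈
        x∈w = subst (x ∈_) (cycPairs-keys w) (∈-map⁺ proj₁ pair∈)
        σx∈w = ∈-rotate⁻ w (subst (σ T r x ∈_) (cycPairs-values w) (∈-map⁺ proj₂ pair∈))
    in ρ , good , subst (x ∈_) w≡ x∈w , subst (σ T r x ∈_) w≡ σx∈w

  -- the root is the last letter of its word, so a followed letter is bad
  followed⇒bad : ∀ {ρ pre x y s} → ¬ Bad ρ → word ρ ≡ pre ++ x ∷ y ∷ s → Bad x
  followed⇒bad {ρ} {pre} {x} {y} {s} good split with bad? x
  ... | yes bad = bad
  ... | no good-x with good-in-word good-x (subst (x ∈_) (sym split) (∈-++⁺ʳ pre (here refl)))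
  ... | refl = let init , ends = word-last x
               in ⊥-elim (last-not-followed init pre s (subst Unique ends (word-unique x)) (trans (sym ends) split))

  followed⇒σ : ∀ {ρ pre x y s} → ¬ Bad ρ → word ρ ≡ pre ++ x ∷ y ∷ s → σ T r x ≡ y
  followed⇒σ {ρ} {pre} {x} {y} {s} good split =
    σ-spec (∈-concatMap⁺ cycPairs {xs = words T r}
      (lose (root⇒words good) (pathPairs⊆cycPairs (word ρ) (subst (λ w → (x , y) ∈ pathPairs w) (sym split)
        (consecutive∈pathPairs pre x y s)))))

  bad⇒followed : ∀ {x} → Bad x →
    Σ (Fin n) λ ρ → Σ (List (Fin n)) λ pre → Σ (List (Fin n)) λ s → ¬ Bad ρ × word ρ ≡ pre ++ x ∷ σ T r x ∷ s
  bad⇒followed {x} bad with inRootWord x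
  ... | ρ , good , x∈ with ∈-∃++ x∈
  ... | pre , y ∷ s , split = ρ , pre , s , good , subst (λ z → word ρ ≡ pre ++ x ∷ z ∷ s) (sym (followed⇒σ good split)) split
  ... | pre , [] , split with word-last ρ
  ... | init , ends with LP.∷ʳ-injective pre init (trans (sym split) ends)
  ... | _ , refl = ⊥-elim (good bad)

-- Φ T r is the tree hung at r with parent function parentΦ: the child of
-- a bad edge is attached to its successor in its word, and the child c of
-- a good edge is attached to σ(parent c).  Both cases are x ↦ σ(attach x).
module PhiParent {n} (r : Fin n) (T : Edges n) (tree : IsTree T) where
  open Permutation r T tree public

  opaque
    attach : Fin n → Fin n
    attach x = if does (bad? x) then x else parent x

    attach-bad : ∀ {x} → Bad x → attach x ≡ x
    attach-bad {x} bad = if-cong (dec-true (bad? x) bad)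

    attach-good : ∀ {x} → ¬ Bad x → attach x ≡ parent x
    attach-good {x} good = if-cong (dec-false (bad? x) good)

    parentΦ : Fin n → Fin n
    parentΦ x = if x == r then r else σ T r (attach x)

    parentΦ-root : parentΦ r ≡ r
    parentΦ-root = if-cong (≡⇒== {a = r} refl)

    parentΦ-nonRoot : ∀ {x} → x ≢ r → parentΦ x ≡ σ T r (attach x)
    parentΦ-nonRoot x≢r = if-cong (≢⇒==false x≢r)

  goodEdge⇒ : ∀ {i j} → (i , j) ∈ goodEdges T r → i ≢ r × j ≡ parent i × i F.< j
  goodEdge⇒ {i} {j} ij∈ with find (∈-concatMap⁻ _ {xs = allFin n} ij∈)
  ... | i′ , _ , ij∈row with ∈-map⁻ (λ j → (i′ , j)) ij∈row
  ... | j′ , j′∈ , refl with ∧-elim {isParent T r i′ j′} (proj₂ (∈-filterᵇ⁻ _ (allFin n) j′∈))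
  ... | i-child , i<j with HungT.childOf⇒parent i-child
  ... | i≢r , j≡pi = i≢r , j≡pi , <ᵇ⇒< i<j

  ⇒goodEdge : ∀ {i} → i ≢ r → i F.< parent i → (i , parent i) ∈ goodEdges T r
  ⇒goodEdge {i} i≢r i<pi = ∈-concatMap⁺ _ {xs = allFin n} (lose (∈-allFin i) (∈-map⁺ (λ j → (i , j))
    (∈-filterᵇ⁺ _ (∈-allFin (parent i)) (∧-intro (HungT.parent⇒childOf i≢r) (<⇒<ᵇ i<pi)))))

  Φ-edge⇒parent : ∀ {x y} → (x , y) ∈ Φ T r → x ≢ r × y ≡ parentΦ x
  Φ-edge⇒parent {x} {y} xy∈ with ∈-++⁻ (concatMap pathPairs (words T r)) xy∈
  ... | inj₁ xy∈path with find (∈-concatMap⁻ pathPairs {xs = words T r} xy∈path)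
  ... | w , w∈ , xy∈w with words⇒root w∈
  ... | ρ , good , refl with pathPairs⇒consecutive (word ρ) xy∈w
  ... | pre , s , split with followed⇒bad good split
  ... | bad = proj₁ bad , sym (trans (parentΦ-nonRoot (proj₁ bad)) (trans (cong (σ T r) (attach-bad bad)) (followed⇒σ good split)))
  Φ-edge⇒parent {x} {y} xy∈ | inj₂ xy∈good with ∈-map⁻ (λ e → (proj₁ e , σ T r (proj₂ e))) xy∈good
  ... | (i , j) , ij∈ , refl with goodEdge⇒ ij∈
  ... | i≢r , refl , i<pi =
    i≢r , sym (trans (parentΦ-nonRoot i≢r) (cong (σ T r) (attach-good (λ bad → ℕP.<-asym i<pi (proj₂ bad)))))

  parent⇒Φ-edge : ∀ {x} → x ≢ r → (x , parentΦ x) ∈ Φ T r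
  parent⇒Φ-edge {x} x≢r with bad? x
  ... | yes bad =
    let ρ , pre , s , good , split = bad⇒followed bad
    in subst (λ z → (x , z) ∈ Φ T r) (sym (trans (parentΦ-nonRoot x≢r) (cong (σ T r) (attach-bad bad))))
         (∈-++⁺ˡ (∈-concatMap⁺ pathPairs {xs = words T r} (lose (root⇒words good)
           (subst (λ w → (x , σ T r x) ∈ pathPairs w) (sym split) (consecutive∈pathPairs pre x (σ T r x) s)))))
  ... | no good =
    subst (λ z → (x , z) ∈ Φ T r) (sym (trans (parentΦ-nonRoot x≢r) (cong (σ T r) (attach-good good))))
      (∈-++⁺ʳ (concatMap pathPairs (words T r))
        (∈-map⁺ (λ e → (proj₁ e , σ T r (proj₂ e))) (⇒goodEdge x≢r (good⇒below-parent x≢r good))))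

  toWordRoot : ∀ {ρ} → ¬ Bad ρ → ∀ pre x s → word ρ ≡ pre ++ x ∷ s → Σ ℕ λ k → iterate parentΦ x k ≡ ρ
  toWordRoot {ρ} good pre x [] split with word-last ρ
  ... | init , ends with LP.∷ʳ-injective pre init (trans (sym split) ends)
  ... | _ , x≡ρ = 0 , x≡ρ
  toWordRoot {ρ} good pre x (y ∷ s) split =
    let bad = followed⇒bad good split
        k , hit = toWordRoot good (pre ++ [ x ]) y s (trans split (sym (LP.++-assoc pre [ x ] (y ∷ s))))
    in suc k , trans (cong (λ z → iterate parentΦ z k)
                 (trans (parentΦ-nonRoot (proj₁ bad)) (trans (cong (σ T r) (attach-bad bad)) (followed⇒σ good split)))) hit

  -- from a component root ρ ≢ r, parentΦ enters the word of a root closer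
  -- to r (the root of the component of parent ρ), and walks on to that root
  rootStep : ∀ {ρ} → ρ ≢ r → ¬ Bad ρ →
    Σ (Fin n) λ ρ₂ → ¬ Bad ρ₂ × dist ρ₂ ℕ.< dist ρ × Σ ℕ λ k → iterate parentΦ ρ k ≡ ρ₂
  rootStep {ρ} ρ≢r good = ρ₂ , good₂ , ρ₂-closer , suc (proj₁ walk) , trans (cong (λ z → iterate parentΦ z (proj₁ walk)) enter) (proj₂ walk)
    where
    sameWord : Σ (Fin n) λ ρ₂ → ¬ Bad ρ₂ × parent ρ ∈ word ρ₂ × σ T r (parent ρ) ∈ word ρ₂
    sameWord = σ-sameWord (parent ρ)
    ρ₂ : Fin n
    ρ₂ = proj₁ sameWord
    good₂ : ¬ Bad ρ₂
    good₂ = proj₁ (proj₂ sameWord)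
    split : Σ (List (Fin n)) λ pre → Σ (List (Fin n)) λ s → word ρ₂ ≡ pre ++ [ σ T r (parent ρ) ] ++ s
    split = ∈-∃++ (proj₂ (proj₂ (proj₂ sameWord)))
    walk : Σ ℕ λ k → iterate parentΦ (σ T r (parent ρ)) k ≡ ρ₂
    walk = toWordRoot good₂ (proj₁ split) (σ T r (parent ρ)) (proj₁ (proj₂ split)) (proj₂ (proj₂ split))
    ρ₂-closer : dist ρ₂ ℕ.< dist ρ
    ρ₂-closer = ℕP.≤-<-trans (badPath-dist (proj₂ (postorder⇒badPath n ρ₂ (proj₁ (proj₂ (proj₂ sameWord)))))) (parent-closer ρ ρ≢r)
    enter : parentΦ ρ ≡ σ T r (parent ρ)
    enter = trans (parentΦ-nonRoot ρ≢r) (cong (σ T r) (attach-good good))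

  rootReachesRoot : ∀ bound ρ → dist ρ ℕ.< bound → ¬ Bad ρ → Σ ℕ λ k → iterate parentΦ ρ k ≡ r
  rootReachesRoot (suc bound) ρ lt good = byCases (ρ ≟ r)
    where
    continue : (Σ (Fin n) λ ρ₂ → ¬ Bad ρ₂ × dist ρ₂ ℕ.< dist ρ × Σ ℕ λ k → iterate parentΦ ρ k ≡ ρ₂) →
      Σ ℕ λ k → iterate parentΦ ρ k ≡ r
    continue (ρ₂ , good₂ , ρ₂-closer , k₁ , hit₁) =
      let k₂ , hit₂ = rootReachesRoot bound ρ₂ (ℕP.<-≤-trans ρ₂-closer (ℕP.≤-pred lt)) good₂
      in k₁ + k₂ , iterate-trans parentΦ k₁ k₂ hit₁ hit₂

    byCases : Dec (ρ ≡ r) → Σ ℕ λ k → iterate parentΦ ρ k ≡ r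
    byCases (yes ρ≡r) = 0 , ρ≡r
    byCases (no ρ≢r) = continue (rootStep ρ≢r good)

  parentΦ-reachesRoot : ∀ x → Σ ℕ λ k → iterate parentΦ x k ≡ r
  parentΦ-reachesRoot x = fromRootWord (inRootWord x)
    where
    fromRootWord : (Σ (Fin n) λ ρ → ¬ Bad ρ × x ∈ word ρ) → Σ ℕ λ k → iterate parentΦ x k ≡ r
    fromRootWord (ρ , good , x∈) =
      let pre , s , split = ∈-∃++ x∈
          k₁ , hit₁ = toWordRoot good pre x s split
          k₂ , hit₂ = rootReachesRoot (suc (dist ρ)) ρ (ℕP.n<1+n (dist ρ)) good
      in k₁ + k₂ , iterate-trans parentΦ k₁ k₂ hit₁ hit₂

  isParentFunctionΦ : IsParentFunction (Φ T r) r parentΦ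
  isParentFunctionΦ = record
    { root-fixed  = parentΦ-root
    ; edge⇒parent = edge⇒parentΦ
    ; parent⇒edge = λ b b≢r → edge⇒adj (Φ T r) (parent⇒Φ-edge b≢r) (inj₂ (refl , refl))
    ; reachesRoot = parentΦ-reachesRoot
    }
    where
    edge⇒parentΦ : ∀ a b → adj (Φ T r) a b ≡ true → (b ≢ r × a ≡ parentΦ b) ⊎ (a ≢ r × b ≡ parentΦ a)
    edge⇒parentΦ a b a~b with adj⇒edge (Φ T r) a~b
    ... | e , e∈ , inj₁ (refl , refl) = inj₂ (Φ-edge⇒parent e∈)
    ... | e , e∈ , inj₂ (refl , refl) = inj₁ (Φ-edge⇒parent e∈)

module LocalSibships {n} (r : Fin n) (T : Edges n) (tree : IsTree T) where
  open PhiParent r T tree public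
  module HungΦ = ParentFunction isParentFunctionΦ

  localSib⇔attach : ∀ v c → LocalSib T r v c ⇔ (c ≢ r × v ≡ attach c)
  localSib⇔attach v c = mk⇔ to from
    where
    to : LocalSib T r v c → c ≢ r × v ≡ attach c
    to (u , _ , u<v , inj₁ (u-child , refl)) with HungT.childOf⇒parent u-child
    ... | u≢r , refl = u≢r , sym (attach-good (λ bad → ℕP.<-asym u<v (proj₂ bad)))
    to (u , _ , u<v , inj₂ (v-child , refl)) with HungT.childOf⇒parent v-child
    ... | v≢r , refl = v≢r , sym (attach-bad (v≢r , u<v))

    from : c ≢ r × v ≡ attach c → LocalSib T r v c
    from (c≢r , refl) with bad? c
    ... | yes bad = subst (λ v → LocalSib T r v c) (sym (attach-bad bad))
                      (parent c , parent-adjacent c c≢r , proj₂ bad , inj₂ (HungT.parent⇒childOf c≢r , refl))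
    ... | no good = subst (λ v → LocalSib T r v c) (sym (attach-good good))
                      (c , adj-sym T (parent-adjacent c c≢r) , good⇒below-parent c≢r good , inj₁ (HungT.parent⇒childOf c≢r , refl))

  localSib⇔childOfσ : ∀ v c → LocalSib T r v c ⇔ ChildOf (Φ T r) r c (σ T r v)
  localSib⇔childOfσ v c = mk⇔
    (λ sib → let c≢r , v≡ = Equivalence.to (localSib⇔attach v c) sib
             in Equivalence.from (HungΦ.childOf⇔parent c (σ T r v))
                  (c≢r , trans (cong (σ T r) v≡) (sym (parentΦ-nonRoot c≢r))))
    (λ child → let c≢r , σv≡ = HungΦ.childOf⇒parent child
               in Equivalence.from (localSib⇔attach v c) (c≢r , σ-injective (trans σv≡ (parentΦ-nonRoot c≢r))))

  sibship⇒childGroup : ∀ v → ∃ (LocalSib T r v) →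
    Σ (Fin n) λ w → ∃ (λ c → ChildOf (Φ T r) r c w) × (∀ c → LocalSib T r v c ⇔ ChildOf (Φ T r) r c w)
  sibship⇒childGroup v (c , sib) = σ T r v , (c , Equivalence.to (localSib⇔childOfσ v c) sib) , localSib⇔childOfσ v

  childGroup⇒sibship : ∀ w → ∃ (λ c → ChildOf (Φ T r) r c w) →
    Σ (Fin n) λ v → ∃ (LocalSib T r v) × (∀ c → LocalSib T r v c ⇔ ChildOf (Φ T r) r c w)
  childGroup⇒sibship w (c , child) = fromPreimage (σ-surjective w)
    where
    fromPreimage : (∃ λ v → σ T r v ≡ w) →
      Σ (Fin n) λ v → ∃ (LocalSib T r v) × (∀ c → LocalSib T r v c ⇔ ChildOf (Φ T r) r c w)
    fromPreimage (v , σv≡w) =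
      v , (c , Equivalence.from (localSib⇔childOfσ v c) (subst (ChildOf (Φ T r) r c) (sym σv≡w) child))
        , λ c′ → subst (λ z → LocalSib T r v c′ ⇔ ChildOf (Φ T r) r c′ z) σv≡w (localSib⇔childOfσ v c′)

lemma3p4 : ∀ {n} (r : Fin n) (T : Edges n) → IsTree T →
    (∀ v c → LocalSib T r v c ⇔ ChildOf (Φ T r) r c (σ T r v))
    × (∀ v → ∃ (LocalSib T r v) →
         Σ (Fin n) λ w → ∃ (λ c → ChildOf (Φ T r) r c w)
           × (∀ c → LocalSib T r v c ⇔ ChildOf (Φ T r) r c w))
    × (∀ w → ∃ (λ c → ChildOf (Φ T r) r c w) →
         Σ (Fin n) λ v → ∃ (LocalSib T r v)
           × (∀ c → LocalSib T r v c ⇔ ChildOf (Φ T r) r c w))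
lemma3p4 r T tree = localSib⇔childOfσ , sibship⇒childGroup , childGroup⇒sibship
  where open LocalSibships r T tree
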